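{- There is no mixed graph with maximum undirected degree $1$, maximum out-degree $1$, diameter $4$, and $18$ vertices (i.e., no almost mixed Moore graph with $r=z=1$ and diameter $4$, whose order would be $M(1,1,4)-1=18$).
   Context: A mixed graph has a vertex set, a set of (undirected) edges and a set of arcs. The undirected degree of a vertex is the number of edges incident with it, and its out-degree the number of arcs leaving it. Walks traverse edges in either direction and arcs only forward; the diameter is the maximum over ordered pairs $(u,v)$ of the length of a shortest walk from $u$ to $v$. The Moore bound for $r=z=1$ and diameter $4$ is $M(1,1,4)=19$; an almost mixed Moore graph has order one less than the Moore bound. -}

module Defs where

open import Data.Nat using (ℕ; zero; suc; _≤_)
open import Data.Fin using (Fin)
open import Data.Bool using (Bool; true; false; T)
open import Data.Bool.Properties using (T?)
open import Data.List using (List; length; filter)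
open import Data.List.Base using () renaming (allFin to allFinL)
open import Data.Product using (Σ; ∃; _×_; _,_)
open import Data.Sum using (_⊎_)
open import Relation.Nullary using (¬_)
open import Relation.Binary.PropositionalEquality using (_≡_)

-- In particular a
-- digon of arcs is not allowed (it is regarded as an edge).
record MixedGraph (n : ℕ) : Set where
  field
    edge : Fin n → Fin n → Bool
    arc  : Fin n → Fin n → Bool
    edge-irrefl : ∀ u → ¬ T (edge u u)
    arc-irrefl  : ∀ u → ¬ T (arc u u)
    edge-sym    : ∀ u v → T (edge u v) → T (edge v u)
    arc-notEdge : ∀ u v → T (arc u v) → ¬ T (edge u v)
    arc-asym    : ∀ u v → T (arc u v) → ¬ T (arc v u)

module _ {n : ℕ} (G : MixedGraph n) where
  open MixedGraph G

  undegree : Fin n → ℕ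
  undegree u = length (filter (λ v → T? (edge u v)) (allFinL n))

  outdegree : Fin n → ℕ
  outdegree u = length (filter (λ v → T? (arc u v)) (allFinL n))

  MaxUndegree : ℕ → Set
  MaxUndegree r = (∀ u → undegree u ≤ r) × (∃ λ u → undegree u ≡ r)

  MaxOutdegree : ℕ → Set
  MaxOutdegree z = (∀ u → outdegree u ≤ z) × (∃ λ u → outdegree u ≡ z)

  Step : Fin n → Fin n → Set
  Step u v = T (edge u v) ⊎ T (arc u v)

  data Walk : ℕ → Fin n → Fin n → Set where
    [] : ∀ {u} → Walk zero u u
    _∷_ : ∀ {k u v w} → Step u v → Walk k v w → Walk (suc k) u w

  DistLE : ℕ → Fin n → Fin n → Set
  DistLE k u v = ∃ λ j → j ≤ k × Walk j u v

  Diameter : ℕ → Set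
  Diameter d = (∀ u v → DistLE d u v)
             × (∃ λ u → ∃ λ v → ∀ k → DistLE k u v → d ≤ k)

-- With undirected and out-degree at most 1 every vertex has at most one edge-neighbour and
-- one out-neighbour, and a shortest walk never uses two edges in a row (it would go back and
-- forth along the same edge). Hence the vertices within distance 4 of u lie on a Moore tree
-- rooted at u with 1 + 2 + 3 + 5 + 8 = 19 nodes, and in a graph on 18 vertices of diameter 4
-- these trees can repeat at most one vertex. A search builds the graph one adjacency at a
-- time, labelling vertices in order of discovery, and discards a partial graph as soon as a
-- local axiom fails or some tree is seen to cover fewer than 18 vertices, whatever the
-- unknown adjacencies. The search closes every branch, which is checked by evaluation; an
-- actual graph would keep one branch alive, since it embeds into a child of every partial
-- graph it embeds into.
module Submission where

open import Defs
open import Data.Bool using (Bool; true; false; _∧_; _∨_; if_then_else_; T)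
open import Data.Bool.ListAction using (any; all)
open import Data.Bool.Properties using (T?; T-∧; T-∨)
open import Data.Empty using (⊥; ⊥-elim)
open import Data.Fin as Fin using (Fin; toℕ)
open import Data.Fin.Properties using (any?; pigeonhole; toℕ<n)
open import Data.List using (List; []; _∷_; _++_; length; map; foldr; concatMap; upTo; lookup)
open import Data.List.Properties using (length-++; length-map)
open import Data.List.Membership.Propositional using (_∈_)
open import Data.List.Membership.Propositional.Properties
  using (∈-filter⁺; ∈-++⁺ˡ; ∈-++⁺ʳ; ∈-map⁺; ∈-allFin; ∈-upTo⁺; ∈-concatMap⁺)
open import Data.List.Relation.Unary.Any as Any using (here; there; index; satisfied)
open import Data.List.Relation.Unary.Any.Properties using (lookup-index; any⁻)
open import Data.List.Relation.Unary.All as All using ()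
open import Data.List.Relation.Unary.All.Properties using (all⁺)
open import Data.Maybe using (Maybe; just; nothing)
open import Data.Nat using (ℕ; zero; suc; _+_; _≡ᵇ_; _<ᵇ_; _≤_; _<_; z≤n; s≤s; _≟_; _<?_)
open import Data.Nat.ListAction using (sum)
open import Data.Nat.Properties
  using (≡ᵇ⇒≡; ≡⇒≡ᵇ; <ᵇ⇒<; <⇒<ᵇ; ≮⇒≥; <-irrefl; ≤-refl; ≤-trans; ≤-reflexive; n≤1+n; n<1+n; m≤n⇒m≤1+n;
         ≤∧≢⇒<; <-≤-trans; ≤-<-trans; +-mono-≤; anyUpTo?)
open import Data.Product using (Σ; ∃; _×_; _,_; proj₂)
open import Data.Sum using (_⊎_; inj₁; inj₂)
open import Data.Unit using (⊤; tt)
open import Function using (_∘_; Equivalence)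
open import Relation.Nullary using (¬_; Dec; yes; no)
open import Relation.Binary.PropositionalEquality using (_≡_; _≢_; refl; sym; trans; cong; subst; subst₂)

T-∧⁻ : ∀ {x y} → T (x ∧ y) → T x × T y
T-∧⁻ = Equivalence.to T-∧

T-∨⁻ : ∀ {x y} → T (x ∨ y) → T x ⊎ T y
T-∨⁻ = Equivalence.to T-∨

T-if : ∀ {b x} → T b → T (if b then x else true) → T x
T-if {true} _ h = h

any-upTo-sound : ∀ m (f : ℕ → Bool) → (∀ a → ¬ T (f a)) → ¬ T (any f (upTo m))
any-upTo-sound m f never h = never _ (proj₂ (satisfied (any⁻ f (upTo m) h)))

all-upTo : ∀ m (f : ℕ → Bool) {v} → T (all f (upTo m)) → v < m → T (f v)
all-upTo m f h v<m = All.lookup (all⁺ f (upTo m) h) (∈-upTo⁺ v<m)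

∈-length≤1 : ∀ {A : Set} {xs : List A} {y y′ : A} → length xs ≤ 1 → y ∈ xs → y′ ∈ xs → y ≡ y′
∈-length≤1 {xs = _ ∷ []} _ (here p) (here q) = trans p (sym q)
∈-length≤1 {xs = _ ∷ _ ∷ _} (s≤s ()) _ _

complete⇒n≤length : ∀ {n} (L : List (Fin n)) → (∀ y → y ∈ L) → n ≤ length L
complete⇒n≤length L complete = ≮⇒≥ λ length<n →
  let i , j , i<j , same = pigeonhole length<n (index ∘ complete)
      i≡j = trans (lookup-index (complete i))
                  (trans (cong (lookup L) same) (sym (lookup-index (complete j))))
  in <-irrefl (cong toℕ i≡j) i<j

preimage? : ∀ {n} (φ : ℕ → Fin n) m y → Dec (∃ λ v → v < m × φ v ≡ y)
preimage? φ m y = anyUpTo? (λ v → φ v Fin.≟ y) m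

InjectiveBelow : {A : Set} → ℕ → (ℕ → A) → Set
InjectiveBelow m φ = ∀ {a b} → a < m → b < m → φ a ≡ φ b → a ≡ b

injectiveBelow⇒avoidsNothing : ∀ {n} (φ : ℕ → Fin n) → InjectiveBelow n φ →
                               ∀ y → ¬ (∀ v → v < n → φ v ≢ y)
injectiveBelow⇒avoidsNothing {n} φ injective y avoids
  with pigeonhole (n<1+n n) withY
  where
  withY : Fin (suc n) → Fin n
  withY Fin.zero    = y
  withY (Fin.suc i) = φ (toℕ i)
... | Fin.zero  , Fin.suc j , _ , y≡φj = avoids (toℕ j) (toℕ<n j) (sym y≡φj)
... | Fin.suc i , Fin.suc j , i<j , φi≡φj =
  <-irrefl (cong suc (injective (toℕ<n i) (toℕ<n j) φi≡φj)) i<j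

mooreSize : ℕ → Bool → ℕ
mooreSize zero    _     = 1
mooreSize (suc k) true  = suc (mooreSize k false)
mooreSize (suc k) false = suc (mooreSize k true + mooreSize k false)

data Link : Set where
  viaEdge viaArc : Link

module Sparse {n} (G : MixedGraph n)
              (undegree≤1 : ∀ u → undegree G u ≤ 1) (outdegree≤1 : ∀ u → outdegree G u ≤ 1) where
  open MixedGraph G

  Vertex : Set
  Vertex = Fin n

  Linked : Link → Vertex → Vertex → Set
  Linked viaEdge u v = T (edge u v)
  Linked viaArc  u v = T (arc u v)

  linked? : ∀ l u v → Dec (Linked l u v)
  linked? viaEdge u v = T? (edge u v)
  linked? viaArc  u v = T? (arc u v)

  linked-functional : ∀ l {u y y′} → Linked l u y → Linked l u y′ → y ≡ y′
  linked-functional viaEdge {u} p q =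
    ∈-length≤1 (undegree≤1 u) (∈-filter⁺ (T? ∘ edge u) (∈-allFin _) p) (∈-filter⁺ (T? ∘ edge u) (∈-allFin _) q)
  linked-functional viaArc {u} p q =
    ∈-length≤1 (outdegree≤1 u) (∈-filter⁺ (T? ∘ arc u) (∈-allFin _) p) (∈-filter⁺ (T? ∘ arc u) (∈-allFin _) q)

  next : Link → Vertex → Maybe Vertex
  next l u with any? (linked? l u)
  ... | yes (v , _) = just v
  ... | no _        = nothing

  next-≡ : ∀ l {u v} → Linked l u v → next l u ≡ just v
  next-≡ l {u} {v} p with any? (linked? l u)
  ... | yes (w , q) = cong just (linked-functional l q p)
  ... | no none     = ⊥-elim (none (v , p))

  mutual
    mooreTree : Vertex → ℕ → Bool → List Vertex
    mooreTree u zero    _     = u ∷ []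
    mooreTree u (suc k) true  = u ∷ below (next viaArc u) k false
    mooreTree u (suc k) false = u ∷ below (next viaEdge u) k true ++ below (next viaArc u) k false

    below : Maybe Vertex → ℕ → Bool → List Vertex
    below nothing  _ _         = []
    below (just v) k afterEdge = mooreTree v k afterEdge

  mutual
    length-mooreTree : ∀ u k afterEdge → length (mooreTree u k afterEdge) ≤ mooreSize k afterEdge
    length-mooreTree u zero    _     = ≤-refl
    length-mooreTree u (suc k) true  = s≤s (length-below (next viaArc u) k false)
    length-mooreTree u (suc k) false = s≤s (≤-trans (≤-reflexive (length-++ viaEdgePart))
      (+-mono-≤ (length-below (next viaEdge u) k true) (length-below (next viaArc u) k false)))
      where viaEdgePart = below (next viaEdge u) k true

    length-below : ∀ w k afterEdge → length (below w k afterEdge) ≤ mooreSize k afterEdge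
    length-below nothing  _ _         = z≤n
    length-below (just v) k afterEdge = length-mooreTree v k afterEdge

  root∈mooreTree : ∀ u k afterEdge → u ∈ mooreTree u k afterEdge
  root∈mooreTree u zero    _     = here refl
  root∈mooreTree u (suc k) true  = here refl
  root∈mooreTree u (suc k) false = here refl

  ∈-below : ∀ {w v y k afterEdge} → w ≡ just v → y ∈ mooreTree v k afterEdge → y ∈ below w k afterEdge
  ∈-below refl y∈ = y∈

  -- The flag records that the previous step was an edge.
  NonBacktracking : ∀ {k u v} → Bool → Walk G k u v → Set
  NonBacktracking _     []           = ⊤
  NonBacktracking true  (inj₁ _ ∷ w) = ⊥
  NonBacktracking false (inj₁ _ ∷ w) = NonBacktracking true w
  NonBacktracking _     (inj₂ _ ∷ w) = NonBacktracking false w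

  nonBacktracking-weaken : ∀ {k u v} (w : Walk G k u v) → NonBacktracking true w → NonBacktracking false w
  nonBacktracking-weaken []           _  = tt
  nonBacktracking-weaken (inj₂ _ ∷ _) nb = nb

  removeBacktracks : ∀ {k u v} → Walk G k u v → ∃ λ j → j ≤ k × Σ (Walk G j u v) (NonBacktracking false)
  removeBacktracks [] = 0 , z≤n , [] , tt
  removeBacktracks (inj₂ a ∷ w) with removeBacktracks w
  ... | j , j≤k , w′ , nb = suc j , s≤s j≤k , inj₂ a ∷ w′ , nb
  removeBacktracks (inj₁ e ∷ w) with removeBacktracks w
  ... | _ , _ , [] , _ = 1 , s≤s z≤n , inj₁ e ∷ [] , tt
  ... | j , j≤k , inj₂ a ∷ w′ , nb = suc j , s≤s j≤k , inj₁ e ∷ inj₂ a ∷ w′ , nb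
  ... | suc j , j≤k , inj₁ e′ ∷ w′ , nb with linked-functional viaEdge e′ (edge-sym _ _ e)
  ...   | refl = j , ≤-trans (n≤1+n j) (m≤n⇒m≤1+n j≤k) , w′ , nonBacktracking-weaken w′ nb

  ∈-mooreTree : ∀ {j u y} afterEdge k (w : Walk G j u y) → NonBacktracking afterEdge w → j ≤ k →
                y ∈ mooreTree u k afterEdge
  ∈-mooreTree afterEdge k [] _ _ = root∈mooreTree _ k afterEdge
  ∈-mooreTree _ zero (_ ∷ _) _ ()
  ∈-mooreTree true (suc k) (inj₁ _ ∷ _) ()
  ∈-mooreTree false (suc k) (inj₁ e ∷ w) nb (s≤s j≤k) =
    there (∈-++⁺ˡ (∈-below (next-≡ viaEdge e) (∈-mooreTree true k w nb j≤k)))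
  ∈-mooreTree true (suc k) (inj₂ a ∷ w) nb (s≤s j≤k) =
    there (∈-below (next-≡ viaArc a) (∈-mooreTree false k w nb j≤k))
  ∈-mooreTree false (suc k) (inj₂ a ∷ w) nb (s≤s j≤k) =
    there (∈-++⁺ʳ (below (next viaEdge _) k true) (∈-below (next-≡ viaArc a) (∈-mooreTree false k w nb j≤k)))

-- A partial graph has vertices labelled 0, …, size - 1, each with a partner entry and an
-- out-neighbour entry; entries of unlabelled vertices are unknown.
data Entry : Set where
  unknown none : Entry
  to : ℕ → Entry

_!_ : List Entry → ℕ → Entry
[]       ! _     = unknown
(e ∷ _)  ! zero  = e
(_ ∷ es) ! suc i = es ! i

_[_]≔_ : List Entry → ℕ → Entry → List Entry
[]       [ zero  ]≔ e = e ∷ []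
[]       [ suc i ]≔ e = unknown ∷ ([] [ i ]≔ e)
(_ ∷ es) [ zero  ]≔ e = e ∷ es
(x ∷ es) [ suc i ]≔ e = x ∷ (es [ i ]≔ e)

!-≔-same : ∀ es i e → (es [ i ]≔ e) ! i ≡ e
!-≔-same []       zero    e = refl
!-≔-same []       (suc i) e = !-≔-same [] i e
!-≔-same (_ ∷ es) zero    e = refl
!-≔-same (_ ∷ es) (suc i) e = !-≔-same es i e

!-≔-other : ∀ es {i j} e → j ≢ i → (es [ i ]≔ e) ! j ≡ es ! j
!-≔-other []       {zero}  {zero}  e j≢i = ⊥-elim (j≢i refl)
!-≔-other []       {zero}  {suc j} e j≢i = refl
!-≔-other []       {suc i} {zero}  e j≢i = refl
!-≔-other []       {suc i} {suc j} e j≢i = !-≔-other [] e (j≢i ∘ cong suc)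
!-≔-other (_ ∷ es) {zero}  {zero}  e j≢i = ⊥-elim (j≢i refl)
!-≔-other (_ ∷ es) {zero}  {suc j} e j≢i = refl
!-≔-other (_ ∷ es) {suc i} {zero}  e j≢i = refl
!-≔-other (_ ∷ es) {suc i} {suc j} e j≢i = !-≔-other es e (j≢i ∘ cong suc)

record Partial : Set where
  constructor partial
  field
    size    : ℕ
    partner : List Entry
    out     : List Entry
open Partial

initial : Partial
initial = partial 1 [] []

entry : Link → Partial → List Entry
entry viaEdge = partner
entry viaArc  = out

grown : Partial → Partial
grown (partial m P F) = partial (suc m) P F

setEntry : Link → Partial → ℕ → Entry → Partial
setEntry viaEdge (partial m P F) a e = partial m (P [ a ]≔ e) F
setEntry viaArc  (partial m P F) a e = partial m P (F [ a ]≔ e)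

attach : Link → Partial → ℕ → ℕ → Partial
attach viaEdge p a v = setEntry viaEdge (setEntry viaEdge p a (to v)) v (to a)
attach viaArc  p a v = setEntry viaArc p a (to v)

-- A stub stands for the subtree reached from a labelled vertex through a link whose entry is
-- still unknown.
record Stub : Set where
  constructor stub
  field
    base      : ℕ
    link      : Link
    depth     : ℕ
    afterEdge : Bool

record Cover : Set where
  constructor cover⟨_,_⟩
  field
    known : List ℕ
    stubs : List Stub
open Cover

_⊕_ : Cover → Cover → Cover
cover⟨ k , s ⟩ ⊕ cover⟨ k′ , s′ ⟩ = cover⟨ k ++ k′ , s ++ s′ ⟩

mutual
  cover : Partial → ℕ → Bool → ℕ → Cover
  cover p zero    _     a = cover⟨ a ∷ [] , [] ⟩
  cover p (suc k) true  a = cover⟨ a ∷ [] , [] ⟩ ⊕ follow p k viaArc false a (out p ! a)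
  cover p (suc k) false a =
    cover⟨ a ∷ [] , [] ⟩ ⊕ (follow p k viaEdge true a (partner p ! a) ⊕ follow p k viaArc false a (out p ! a))

  follow : Partial → ℕ → Link → Bool → ℕ → Entry → Cover
  follow p k l afterEdge a unknown = cover⟨ [] , stub a l k afterEdge ∷ [] ⟩
  follow p k l afterEdge a none    = cover⟨ [] , [] ⟩
  follow p k l afterEdge a (to b)  = cover p k afterEdge b

addNew : ℕ → List ℕ → List ℕ
addNew x ys = if any (x ≡ᵇ_) ys then ys else x ∷ ys

distinct : List ℕ → List ℕ
distinct = foldr addNew []

∈-addNew-new : ∀ x ys → x ∈ addNew x ys
∈-addNew-new x ys with any (x ≡ᵇ_) ys in present
... | true  = Any.map (λ {y} → ≡ᵇ⇒≡ x y) (any⁻ (x ≡ᵇ_) ys (subst T (sym present) tt))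
... | false = here refl

∈-addNew-old : ∀ x {y ys} → y ∈ ys → y ∈ addNew x ys
∈-addNew-old x {ys = ys} y∈ with any (x ≡ᵇ_) ys
... | true  = y∈
... | false = there y∈

∈-distinct : ∀ xs {b} → b ∈ xs → b ∈ distinct xs
∈-distinct (x ∷ xs) (here refl) = ∈-addNew-new x (distinct xs)
∈-distinct (x ∷ xs) (there b∈) = ∈-addNew-old x (∈-distinct xs b∈)

stubSize : Stub → ℕ
stubSize (stub _ _ k afterEdge) = mooreSize k afterEdge

bound : Cover → ℕ
bound c = length (distinct (known c)) + sum (map stubSize (stubs c))

targets : Entry → ℕ → Bool
targets (to b) c = b ≡ᵇ c
targets _      c = false

targets-≡ : ∀ e c → T (targets e c) → e ≡ to c
targets-≡ (to b) c h = cong to (≡ᵇ⇒≡ b c h)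

sameTarget : Entry → Entry → Bool
sameTarget (to b) e = targets e b
sameTarget _      e = false

reversedBy : Partial → ℕ → Entry → Bool
reversedBy p a (to b) = targets (out p ! b) a
reversedBy p a _      = false

illegalAt : Partial → ℕ → Bool
illegalAt p a = targets (partner p ! a) a ∨ targets (out p ! a) a
              ∨ sameTarget (partner p ! a) (out p ! a) ∨ reversedBy p a (out p ! a)

partnerAvailable : ℕ → Entry → Bool
partnerAvailable a unknown = true
partnerAvailable a none    = false
partnerAvailable a (to c)  = c ≡ᵇ a

attachable : Link → Partial → ℕ → ℕ → Bool
attachable viaEdge p a v = partnerAvailable a (partner p ! v)
attachable viaArc  p a v = true

isUnknown : Entry → Bool
isUnknown unknown = true
isUnknown _       = false

gapFrom : Partial → ℕ → ℕ → Maybe (ℕ × Link)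
gapFrom p a zero    = nothing
gapFrom p a (suc r) =
  if isUnknown (partner p ! a) then just (a , viaEdge)
  else if isUnknown (out p ! a) then just (a , viaArc)
  else gapFrom p (suc a) r

firstGap : Partial → Maybe (ℕ × Link)
firstGap p = gapFrom p 0 (size p)

-- n is the order of the graph sought and d a bound on its diameter.
module Search (n d : ℕ) where

  tooSmallAt : Partial → ℕ → Bool
  tooSmallAt p a = bound (cover p d false a) <ᵇ n

  dead : Partial → Bool
  dead p = any (illegalAt p) (upTo (size p)) ∨ any (tooSmallAt p) (upTo (size p))

  -- A true result means that no graph extends the partial graph; fuel bounds the depth.
  mutual
    refute : ℕ → Partial → Bool
    refute zero        p = false
    refute (suc fuel) p = dead p ∨ refuteGap fuel p (firstGap p)

    refuteGap : ℕ → Partial → Maybe (ℕ × Link) → Bool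
    refuteGap fuel p nothing        = false
    refuteGap fuel p (just (a , l)) = (a <ᵇ size p) ∧ refuteFill fuel p a l

    refuteFill : ℕ → Partial → ℕ → Link → Bool
    refuteFill fuel p a l =
      refute fuel (setEntry l p a none)
      ∧ all (refuteAttach fuel p a l) (upTo (size p))
      ∧ (if size p <ᵇ n then refute fuel (attach l (grown p) a (size p)) else true)

    refuteAttach : ℕ → Partial → ℕ → Link → ℕ → Bool
    refuteAttach fuel p a l v = if attachable l p a v then refute fuel (attach l p a v) else true

-- Stated with _≡_: checking tt against T (Search.refute 18 4 40 initial) is several times slower.
search-refutes : Search.refute 18 4 40 initial ≡ true
search-refutes = refl

module Soundness {n} (G : MixedGraph n)
                 (undegree≤1 : ∀ u → undegree G u ≤ 1) (outdegree≤1 : ∀ u → outdegree G u ≤ 1)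
                 {d} (diameter≤d : ∀ u v → DistLE G d u v) where
  open MixedGraph G
  open Sparse G undegree≤1 outdegree≤1

  Realises : Link → (ℕ → Vertex) → ℕ → ℕ → Entry → Set
  Realises l φ m c unknown = ⊤
  Realises l φ m c none    = ∀ y → ¬ Linked l (φ c) y
  Realises l φ m c (to b)  = b < m × Linked l (φ c) (φ b)

  record Describes (l : Link) (φ : ℕ → Vertex) (m : ℕ) (es : List Entry) : Set where
    constructor describing
    field
      realised : ∀ c → Realises l φ m c (es ! c)
      fresh    : ∀ c → m ≤ c → es ! c ≡ unknown

  -- φ c is the vertex of G carrying label c.
  record Embeds (φ : ℕ → Vertex) (p : Partial) : Set where
    field
      injective : InjectiveBelow (size p) φ
      describes : ∀ l → Describes l φ (size p) (entry l p)

    realises : ∀ l c → Realises l φ (size p) c (entry l p ! c)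
    realises l = Describes.realised (describes l)

  embeds-initial : ∀ u → Embeds (λ _ → u) initial
  embeds-initial u = record
    { injective = λ { (s≤s z≤n) (s≤s z≤n) _ → refl }
    ; describes = λ { viaEdge → describing (λ _ → tt) (λ _ _ → refl)
                    ; viaArc  → describing (λ _ → tt) (λ _ _ → refl) } }

  describes-update : ∀ {l φ m es a} e → Describes l φ m es → a < m → Realises l φ m a e →
                     Describes l φ m (es [ a ]≔ e)
  describes-update {l} {φ} {m} {es} {a} e (describing realised fresh) a<m ea = describing realised′ fresh′
    where
    realised′ : ∀ c → Realises l φ m c ((es [ a ]≔ e) ! c)
    realised′ c with c ≟ a
    ... | yes refl = subst (Realises l φ m c) (sym (!-≔-same es c e)) ea
    ... | no c≢a   = subst (Realises l φ m c) (sym (!-≔-other es e c≢a)) (realised c)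
    fresh′ : ∀ c → m ≤ c → (es [ a ]≔ e) ! c ≡ unknown
    fresh′ c m≤c = trans (!-≔-other es e (λ { refl → <-irrefl refl (<-≤-trans a<m m≤c) })) (fresh c m≤c)

  extend : (ℕ → Vertex) → ℕ → Vertex → ℕ → Vertex
  extend φ m y b = if b ≡ᵇ m then y else φ b

  extend-old : ∀ φ {m} y {b} → b < m → extend φ m y b ≡ φ b
  extend-old φ {m} y {b} b<m with b ≡ᵇ m in eq
  ... | true  = ⊥-elim (<-irrefl (≡ᵇ⇒≡ b m (subst T (sym eq) tt)) b<m)
  ... | false = refl

  extend-new : ∀ φ m y → extend φ m y m ≡ y
  extend-new φ m y with m ≡ᵇ m in eq
  ... | true  = refl
  ... | false = ⊥-elim (subst T eq (≡⇒≡ᵇ m m refl))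

  describes-extend : ∀ {l φ m es} y → Describes l φ m es → Describes l (extend φ m y) (suc m) es
  describes-extend {l} {φ} {m} {es} y (describing realised fresh) =
    describing realised′ λ c m<c → fresh c (≤-trans (n≤1+n m) m<c)
    where
    lift : ∀ {c} → c < m → ∀ e → Realises l φ m c e → Realises l (extend φ m y) (suc m) c e
    lift c<m unknown _           = tt
    lift c<m none    isolated z r = isolated z (subst (λ x → Linked l x z) (extend-old φ y c<m) r)
    lift c<m (to b)  (b<m , r)   =
      m≤n⇒m≤1+n b<m , subst₂ (Linked l) (sym (extend-old φ y c<m)) (sym (extend-old φ y b<m)) r
    realised′ : ∀ c → Realises l (extend φ m y) (suc m) c (es ! c)
    realised′ c with c <? m
    ... | yes c<m = lift c<m (es ! c) (realised c)
    ... | no c≮m  = subst (Realises l (extend φ m y) (suc m) c) (sym (fresh c (≮⇒≥ c≮m))) tt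

  embeds-grown : ∀ {φ p} y → Embeds φ p → (∀ v → v < size p → φ v ≢ y) → Embeds (extend φ (size p) y) (grown p)
  embeds-grown {φ} {p} y I avoids = record
    { injective = injective′
    ; describes = λ { viaEdge → describes-extend y (describes viaEdge)
                    ; viaArc  → describes-extend y (describes viaArc) } }
    where
    open Embeds I
    m = size p
    old : ∀ {a} → a < m → extend φ m y a ≡ φ a
    old = extend-old φ y
    injective′ : InjectiveBelow (suc m) (extend φ m y)
    injective′ {a} {b} (s≤s a≤m) (s≤s b≤m) same with a ≟ m | b ≟ m
    ... | yes refl | yes refl = refl
    ... | yes refl | no b≢m   = let b<m = ≤∧≢⇒< b≤m b≢m in
      ⊥-elim (avoids b b<m (trans (sym (old b<m)) (trans (sym same) (extend-new φ m y))))
    ... | no a≢m   | yes refl = let a<m = ≤∧≢⇒< a≤m a≢m in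
      ⊥-elim (avoids a a<m (trans (sym (old a<m)) (trans same (extend-new φ m y))))
    ... | no a≢m   | no b≢m   = let a<m = ≤∧≢⇒< a≤m a≢m ; b<m = ≤∧≢⇒< b≤m b≢m in
      injective a<m b<m (trans (sym (old a<m)) (trans same (old b<m)))

  embeds-setEntry : ∀ {φ p a} l e → Embeds φ p → a < size p → Realises l φ (size p) a e →
                    Embeds φ (setEntry l p a e)
  embeds-setEntry viaEdge e I a<m ea = record
    { injective = Embeds.injective I
    ; describes = λ { viaEdge → describes-update e (Embeds.describes I viaEdge) a<m ea
                    ; viaArc  → Embeds.describes I viaArc } }
  embeds-setEntry viaArc e I a<m ea = record
    { injective = Embeds.injective I
    ; describes = λ { viaEdge → Embeds.describes I viaEdge
                    ; viaArc  → describes-update e (Embeds.describes I viaArc) a<m ea } }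

  embeds-attach : ∀ {φ p a v} l → Embeds φ p → a < size p → v < size p → Linked l (φ a) (φ v) →
                  Embeds φ (attach l p a v)
  embeds-attach viaEdge I a<m v<m e =
    embeds-setEntry viaEdge (to _) (embeds-setEntry viaEdge (to _) I a<m (v<m , e)) v<m (a<m , edge-sym _ _ e)
  embeds-attach viaArc I a<m v<m r = embeds-setEntry viaArc (to _) I a<m (v<m , r)

  stubVertices : (ℕ → Vertex) → Stub → List Vertex
  stubVertices φ (stub c l k afterEdge) = below (next l (φ c)) k afterEdge

  Covered : (ℕ → Vertex) → Cover → Vertex → Set
  Covered φ c y = (∃ λ b → b ∈ known c × φ b ≡ y) ⊎ (∃ λ s → s ∈ stubs c × y ∈ stubVertices φ s)

  covered-⊕ˡ : ∀ {φ} c c′ {y} → Covered φ c y → Covered φ (c ⊕ c′) y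
  covered-⊕ˡ cover⟨ _ , _ ⟩ cover⟨ _ , _ ⟩ (inj₁ (b , b∈ , eq)) = inj₁ (b , ∈-++⁺ˡ b∈ , eq)
  covered-⊕ˡ cover⟨ _ , _ ⟩ cover⟨ _ , _ ⟩ (inj₂ (s , s∈ , y∈)) = inj₂ (s , ∈-++⁺ˡ s∈ , y∈)

  covered-⊕ʳ : ∀ {φ} c c′ {y} → Covered φ c′ y → Covered φ (c ⊕ c′) y
  covered-⊕ʳ cover⟨ k , _ ⟩ cover⟨ _ , _ ⟩ (inj₁ (b , b∈ , eq)) = inj₁ (b , ∈-++⁺ʳ k b∈ , eq)
  covered-⊕ʳ cover⟨ _ , s ⟩ cover⟨ _ , _ ⟩ (inj₂ (t , t∈ , y∈)) = inj₂ (t , ∈-++⁺ʳ s t∈ , y∈)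

  module _ {φ p} (I : Embeds φ p) where
    open Embeds I

    mutual
      cover-covers : ∀ k afterEdge a {j y} (w : Walk G j (φ a) y) → NonBacktracking afterEdge w → j ≤ k →
                     Covered φ (cover p k afterEdge a) y
      cover-covers zero    _     a []           _  _ = inj₁ (a , here refl , refl)
      cover-covers (suc k) true  a []           _  _ = inj₁ (a , here refl , refl)
      cover-covers (suc k) false a []           _  _ = inj₁ (a , here refl , refl)
      cover-covers zero    _     a (_ ∷ _)      _  ()
      cover-covers (suc k) true  a (inj₁ _ ∷ _) ()
      cover-covers (suc k) false a (inj₁ e ∷ w) nb (s≤s j≤k) =
        covered-⊕ʳ cover⟨ a ∷ [] , [] ⟩ _ (covered-⊕ˡ (follow p k viaEdge true a (partner p ! a)) _
          (follow-covers k viaEdge true a (partner p ! a) (realises viaEdge a) e w nb j≤k))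
      cover-covers (suc k) true  a (inj₂ r ∷ w) nb (s≤s j≤k) =
        covered-⊕ʳ cover⟨ a ∷ [] , [] ⟩ _
          (follow-covers k viaArc false a (out p ! a) (realises viaArc a) r w nb j≤k)
      cover-covers (suc k) false a (inj₂ r ∷ w) nb (s≤s j≤k) =
        covered-⊕ʳ cover⟨ a ∷ [] , [] ⟩ _ (covered-⊕ʳ (follow p k viaEdge true a (partner p ! a)) _
          (follow-covers k viaArc false a (out p ! a) (realises viaArc a) r w nb j≤k))

      follow-covers : ∀ k l afterEdge a e {j v y} → Realises l φ (size p) a e → Linked l (φ a) v →
                      (w : Walk G j v y) → NonBacktracking afterEdge w → j ≤ k →
                      Covered φ (follow p k l afterEdge a e) y
      follow-covers k l afterEdge a unknown _ r w nb j≤k =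
        inj₂ (stub a l k afterEdge , here refl , ∈-below (next-≡ l r) (∈-mooreTree afterEdge k w nb j≤k))
      follow-covers k l afterEdge a none    isolated r w nb j≤k = ⊥-elim (isolated _ r)
      follow-covers k l afterEdge a (to b)  (_ , r′) r w nb j≤k with linked-functional l r r′
      ... | refl = cover-covers k afterEdge b w nb j≤k

  coveredList : (ℕ → Vertex) → Cover → List Vertex
  coveredList φ c = map φ (distinct (known c)) ++ concatMap (stubVertices φ) (stubs c)

  ∈-coveredList : ∀ {φ} c {y} → Covered φ c y → y ∈ coveredList φ c
  ∈-coveredList {φ} c (inj₁ (b , b∈ , refl)) = ∈-++⁺ˡ (∈-map⁺ φ (∈-distinct (known c) b∈))
  ∈-coveredList {φ} c (inj₂ (s , s∈ , y∈)) =
    ∈-++⁺ʳ (map φ (distinct (known c))) (∈-concatMap⁺ (stubVertices φ) (Any.map (λ { refl → y∈ }) s∈))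

  length-stubVertices : ∀ φ ss → length (concatMap (stubVertices φ) ss) ≤ sum (map stubSize ss)
  length-stubVertices φ [] = z≤n
  length-stubVertices φ (s@(stub c l k afterEdge) ∷ ss) =
    ≤-trans (≤-reflexive (length-++ (stubVertices φ s)))
            (+-mono-≤ (length-below (next l (φ c)) k afterEdge) (length-stubVertices φ ss))

  length-coveredList : ∀ φ c → length (coveredList φ c) ≤ bound c
  length-coveredList φ c =
    ≤-trans (≤-reflexive (length-++ (map φ (distinct (known c)))))
            (+-mono-≤ (≤-reflexive (length-map φ (distinct (known c)))) (length-stubVertices φ (stubs c)))

  tooSmallAt-sound : ∀ {φ p} → Embeds φ p → ∀ a → ¬ T (Search.tooSmallAt n d p a)
  tooSmallAt-sound {φ} {p} I a small =
    <-irrefl refl (≤-<-trans (complete⇒n≤length L complete)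
                             (≤-<-trans (length-coveredList φ c) (<ᵇ⇒< _ _ small)))
    where
    c = cover p d false a
    L = coveredList φ c
    complete : ∀ y → y ∈ L
    complete y with diameter≤d (φ a) y
    ... | j , j≤d , w with removeBacktracks w
    ...   | j′ , j′≤j , w′ , nb = ∈-coveredList c (cover-covers I d false a w′ nb (≤-trans j′≤j j≤d))

  module _ {φ p} (I : Embeds φ p) (a : ℕ) where
    open Embeds I

    loop-illegal : ∀ l → ¬ Linked l (φ a) (φ a) → ¬ T (targets (entry l p ! a) a)
    loop-illegal l irrefl h =
      irrefl (proj₂ (subst (Realises l φ (size p) a) (targets-≡ _ a h) (realises l a)))

    parallel-illegal : ∀ e → Realises viaEdge φ (size p) a e → ¬ T (sameTarget e (out p ! a))
    parallel-illegal (to b) (_ , edge) h with out p ! a | realises viaArc a | targets-≡ (out p ! a) b h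
    ... | _ | (_ , arc) | refl = arc-notEdge _ _ arc edge

    digon-illegal : ∀ e → Realises viaArc φ (size p) a e → ¬ T (reversedBy p a e)
    digon-illegal (to b) (_ , arc) h with out p ! b | realises viaArc b | targets-≡ (out p ! b) a h
    ... | _ | (_ , arc′) | refl = arc-asym _ _ arc arc′

    illegalAt-sound : ¬ T (illegalAt p a)
    illegalAt-sound h with T-∨⁻ {targets (partner p ! a) a} h
    ... | inj₁ loop = loop-illegal viaEdge (edge-irrefl _) loop
    ... | inj₂ h′ with T-∨⁻ {targets (out p ! a) a} h′
    ...   | inj₁ loop = loop-illegal viaArc (arc-irrefl _) loop
    ...   | inj₂ h″ with T-∨⁻ {sameTarget (partner p ! a) (out p ! a)} h″
    ...     | inj₁ parallel = parallel-illegal (partner p ! a) (realises viaEdge a) parallel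
    ...     | inj₂ digon    = digon-illegal (out p ! a) (realises viaArc a) digon

  dead-sound : ∀ {φ p} → Embeds φ p → ¬ T (Search.dead n d p)
  dead-sound {p = p} I h with T-∨⁻ {any (illegalAt p) (upTo (size p))} h
  ... | inj₁ illegal = any-upTo-sound (size p) (illegalAt p) (illegalAt-sound I) illegal
  ... | inj₂ small   = any-upTo-sound (size p) (Search.tooSmallAt n d p) (tooSmallAt-sound I) small

  -- Otherwise the first n labels would already name every vertex of G.
  room-for-new : ∀ {φ p y} → Embeds φ p → (∀ v → v < size p → φ v ≢ y) → T (size p <ᵇ n)
  room-for-new {φ} {p} {y} I avoids with size p <? n
  ... | yes m<n = <⇒<ᵇ m<n
  ... | no m≮n  = ⊥-elim (injectiveBelow⇒avoidsNothing φ
                            (λ a<n b<n → injective (<-≤-trans a<n n≤m) (<-≤-trans b<n n≤m))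
                            y (λ v v<n → avoids v (<-≤-trans v<n n≤m)))
    where
    open Embeds I
    n≤m = ≮⇒≥ m≮n

  attachable-sound : ∀ {φ p a v} l → Embeds φ p → a < size p → Linked l (φ a) (φ v) → T (attachable l p a v)
  attachable-sound {φ} {p} {a} {v} viaEdge I a<m e = available (partner p ! v) (Embeds.realises I viaEdge v)
    where
    available : ∀ e′ → Realises viaEdge φ (size p) v e′ → T (partnerAvailable a e′)
    available unknown _          = tt
    available none    isolated   = isolated _ (edge-sym _ _ e)
    available (to c)  (c<m , e′) =
      ≡⇒≡ᵇ c a (Embeds.injective I c<m a<m (linked-functional viaEdge e′ (edge-sym _ _ e)))
  attachable-sound viaArc I a<m r = tt

  refuteFill-sound : ∀ fuel → (∀ {φ p} → Embeds φ p → ¬ T (Search.refute n d fuel p)) →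
                     ∀ {φ p a} → Embeds φ p → a < size p → ∀ l → ¬ T (Search.refuteFill n d fuel p a l)
  refuteFill-sound fuel IH {φ} {p} {a} I a<m l h
    with T-∧⁻ {Search.refute n d fuel (setEntry l p a none)} h
  ... | unlinked? , h′ with T-∧⁻ {all (Search.refuteAttach n d fuel p a l) (upTo (size p))} h′
  ... | toLabelled? , toNew? with any? (linked? l (φ a))
  ... | no unlinked = IH (embeds-setEntry l none I a<m (λ y r → unlinked (y , r))) unlinked?
  ... | yes (y , r) with preimage? φ (size p) y
  ... | yes (v , v<m , refl) =
    IH (embeds-attach l I a<m v<m r)
       (T-if (attachable-sound l I a<m r) (all-upTo (size p) (Search.refuteAttach n d fuel p a l) toLabelled? v<m))
  ... | no unlabelled =
    IH (embeds-attach l (embeds-grown y I avoids) (m≤n⇒m≤1+n a<m) ≤-refl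
          (subst₂ (Linked l) (sym (extend-old φ y a<m)) (sym (extend-new φ (size p) y)) r))
       (T-if (room-for-new I avoids) toNew?)
    where
    avoids : ∀ v → v < size p → φ v ≢ y
    avoids v v<m φv≡y = unlabelled (v , v<m , φv≡y)

  refute-sound : ∀ fuel {φ p} → Embeds φ p → ¬ T (Search.refute n d fuel p)
  refute-sound zero       I ()
  refute-sound (suc fuel) {p = p} I h with T-∨⁻ {Search.dead n d p} h
  ... | inj₁ isDead = dead-sound I isDead
  ... | inj₂ h′ with firstGap p
  ...   | nothing      = h′
  ...   | just (a , l) = let a<m , h″ = T-∧⁻ {a <ᵇ size p} h′ in
                         refuteFill-sound fuel (refute-sound fuel) I (<ᵇ⇒< a (size p) a<m) l h″

  embedding⇒unrefuted : ∀ fuel {φ p} → Embeds φ p → Search.refute n d fuel p ≢ true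
  embedding⇒unrefuted fuel I refuted = refute-sound fuel I (subst T (sym refuted) tt)

noSparseGraphWithin4 : (G : MixedGraph 18) → (∀ u → undegree G u ≤ 1) → (∀ u → outdegree G u ≤ 1) →
                       ¬ (∀ u v → DistLE G 4 u v)
noSparseGraphWithin4 G undegree≤1 outdegree≤1 diameter≤4 =
  embedding⇒unrefuted 40 (embeds-initial Fin.zero) search-refutes
  where open Soundness G undegree≤1 outdegree≤1 diameter≤4

mainTheorem6 : ¬ (Σ (MixedGraph 18) λ G → MaxUndegree G 1 × MaxOutdegree G 1 × Diameter G 4)
mainTheorem6 (G , (undegree≤1 , _) , (outdegree≤1 , _) , (diameter≤4 , _)) =
  noSparseGraphWithin4 G undegree≤1 outdegree≤1 diameter≤4
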